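{- Let $A$ be a formula, let $\{\ell_1,\ldots,\ell_n\}$ be a non-tautological clause, and let $\pi$ be an $\mathbf{LK}^-$ proof of the split sequent $A;\Rightarrow;\ell_1,\ldots,\ell_n$. Then $\mathrm{CNF}(\mathcal{M}(\pi))=\{M\}$ for some clause $M\subseteq\{\ell_1,\ldots,\ell_n\}$.
   Context: Propositional formulas are built from atoms and $\bot$ using $\wedge,\vee,\neg$; $\top$ abbreviates $\neg\bot\vee\bot$. A literal is an atom (counting $\bot$ as an atom), a negated atom, or $\top$. A clause is a finite set of literals, read as their disjunction; it is non-tautological if this disjunction is not valid. A clause set is a set of clauses. For clause sets, $\mathcal{C}\times\mathcal{D}=\{C\cup D\mid C\in\mathcal{C},D\in\mathcal{D}\}$. $\mathrm{CNF}$ is defined on formulas built from literals by $\wedge,\vee$: $\mathrm{CNF}(\top)=\emptyset$, $\mathrm{CNF}(\bot)=\{\emptyset\}$, $\mathrm{CNF}(\ell)=\{\{\ell\}\}$ for other literals, $\mathrm{CNF}(A\wedge B)=\mathrm{CNF}(A)\cup\mathrm{CNF}(B)$, $\mathrm{CNF}(A\vee B)=\mathrm{CNF}(A)\times\mathrm{CNF}(B)$. $\mathbf{LK}^-$ is the cut-free sequent calculus with axioms $p\Rightarrow p$ ($p$ an atom) and $\bot\Rightarrow$, and rules weakening, contraction (left/right), $(L\wedge_1),(L\wedge_2),(R\wedge),(R\vee_1),(R\vee_2),(L\vee),(L\neg),(R\neg)$ in standard Gentzen G1 form with context multisets. A split sequent $\Gamma_1;\Gamma_2\Rightarrow\Delta_1;\Delta_2$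 is the sequent $\Gamma_1,\Gamma_2\Rightarrow\Delta_1,\Delta_2$ with formulas divided into a left side ($\Gamma_1,\Delta_1$) and a right side ($\Gamma_2,\Delta_2$); in a proof of a split sequent every sequent is split, context formulas keep their side, and auxiliary formulas lie on the same side as the main formula. The Maehara interpolant $\mathcal{M}(\pi)$: axioms $p;\Rightarrow p;$ give $\bot$, $;p\Rightarrow;p$ give $\top$, $p;\Rightarrow;p$ give $p$, $;p\Rightarrow p;$ give $\neg p$, $\bot;\Rightarrow;$ gives $\bot$, $;\bot\Rightarrow;$ gives $\top$; unary rules keep the interpolant of the premise; a binary rule ($(R\wedge)$ or $(L\vee)$) with premise proofs $\pi_1,\pi_2$ gives $\mathcal{M}(\pi_1)\vee\mathcal{M}(\pi_2)$ if its main formula is on the left side and $\mathcal{M}(\pi_1)\wedge\mathcal{M}(\pi_2)$ if on the right side. -}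

module Defs where

open import Data.Nat using (ℕ)
open import Data.Bool using (Bool; true; false; _∧_; _∨_; not)
open import Data.List using (List; []; _∷_; _++_; map; concatMap; foldr)
open import Data.List.Membership.Propositional using (_∈_)
open import Data.List.Relation.Binary.Permutation.Propositional using (_↭_)
open import Data.Product using (_×_; _,_; Σ)
open import Relation.Binary.PropositionalEquality using (_≡_)
open import Relation.Nullary using (¬_)

infixr 6 _∧'_
infixr 5 _∨'_

data Fm : Set where
  var  : ℕ → Fm
  ⊥'   : Fm
  _∧'_ : Fm → Fm → Fm
  _∨'_ : Fm → Fm → Fm
  ¬'_  : Fm → Fm

⊤' : Fm
⊤' = (¬' ⊥') ∨' ⊥'

eval : (ℕ → Bool) → Fm → Bool
eval v (var n)  = v n
eval v ⊥'       = false
eval v (A ∧' B) = eval v A ∧ eval v B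
eval v (A ∨' B) = eval v A ∨ eval v B
eval v (¬' A)   = not (eval v A)

Valid : Fm → Set
Valid A = ∀ (v : ℕ → Bool) → eval v A ≡ true

data LAtom : Set where
  lvar : ℕ → LAtom
  lbot : LAtom

data Literal : Set where
  pos : LAtom → Literal
  neg : LAtom → Literal
  top : Literal

atomFm : LAtom → Fm
atomFm (lvar n) = var n
atomFm lbot     = ⊥'

litFm : Literal → Fm
litFm (pos a) = atomFm a
litFm (neg a) = ¬' atomFm a
litFm top     = ⊤'

-- Clauses (finite sets of literals) are represented by lists, read up to
-- set equality; clause sets by lists of clauses.
Clause : Set
Clause = List Literal

ClauseSet : Set
ClauseSet = List Clause

disj : Clause → Fm
disj C = foldr _∨'_ ⊥' (map litFm C)

NonTautological : Clause → Set
NonTautological C = ¬ Valid (disj C)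

_⊆ᶜ_ : Clause → Clause → Set
C ⊆ᶜ D = ∀ {ℓ} → ℓ ∈ C → ℓ ∈ D

SameClause : Clause → Clause → Set
SameClause C D = (C ⊆ᶜ D) × (D ⊆ᶜ C)

IsSingleton : ClauseSet → Clause → Set
IsSingleton 𝒞 M = (∀ {C} → C ∈ 𝒞 → SameClause C M)
                × Σ Clause (λ C → C ∈ 𝒞 × SameClause C M)

data LFm : Set where
  lit  : Literal → LFm
  _∧ˡ_ : LFm → LFm → LFm
  _∨ˡ_ : LFm → LFm → LFm

_×ᶜ_ : ClauseSet → ClauseSet → ClauseSet
𝒞 ×ᶜ 𝒟 = concatMap (λ C → map (λ D → C ++ D) 𝒟) 𝒞

CNF : LFm → ClauseSet
CNF (lit top)        = []
CNF (lit (pos lbot)) = [] ∷ []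
CNF (lit (pos (lvar n))) = (pos (lvar n) ∷ []) ∷ []
CNF (lit (neg a))    = (neg a ∷ []) ∷ []
CNF (A ∧ˡ B)         = CNF A ++ CNF B
CNF (A ∨ˡ B)         = CNF A ×ᶜ CNF B

-- Split sequents: every formula occurrence is tagged with its side.
-- Γ₁;Γ₂ ⇒ Δ₁;Δ₂ is represented by antecedent/succedent lists of tagged
-- formulas (lft = left side Γ₁,Δ₁; rgt = right side Γ₂,Δ₂).
-- Multisets are modelled by lists together with exchange rules (↭).

data Side : Set where
  lft rgt : Side

SFm : Set
SFm = Side × Fm

data Pf : List SFm → List SFm → Set where
  ax    : ∀ s t p → Pf ((s , var p) ∷ []) ((t , var p) ∷ [])
  ax⊥   : ∀ s → Pf ((s , ⊥') ∷ []) []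
  wL    : ∀ {Γ Δ} x → Pf Γ Δ → Pf (x ∷ Γ) Δ
  wR    : ∀ {Γ Δ} x → Pf Γ Δ → Pf Γ (x ∷ Δ)
  cL    : ∀ {Γ Δ x} → Pf (x ∷ x ∷ Γ) Δ → Pf (x ∷ Γ) Δ
  cR    : ∀ {Γ Δ x} → Pf Γ (x ∷ x ∷ Δ) → Pf Γ (x ∷ Δ)
  exL   : ∀ {Γ Γ' Δ} → Γ ↭ Γ' → Pf Γ Δ → Pf Γ' Δ
  exR   : ∀ {Γ Δ Δ'} → Δ ↭ Δ' → Pf Γ Δ → Pf Γ Δ'
  L∧₁   : ∀ {Γ Δ s A} B → Pf ((s , A) ∷ Γ) Δ → Pf ((s , A ∧' B) ∷ Γ) Δ
  L∧₂   : ∀ {Γ Δ s B} A → Pf ((s , B) ∷ Γ) Δ → Pf ((s , A ∧' B) ∷ Γ) Δ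
  R∧    : ∀ {Γ Δ s A B} → Pf Γ ((s , A) ∷ Δ) → Pf Γ ((s , B) ∷ Δ)
          → Pf Γ ((s , A ∧' B) ∷ Δ)
  R∨₁   : ∀ {Γ Δ s A} B → Pf Γ ((s , A) ∷ Δ) → Pf Γ ((s , A ∨' B) ∷ Δ)
  R∨₂   : ∀ {Γ Δ s B} A → Pf Γ ((s , B) ∷ Δ) → Pf Γ ((s , A ∨' B) ∷ Δ)
  L∨    : ∀ {Γ Δ s A B} → Pf ((s , A) ∷ Γ) Δ → Pf ((s , B) ∷ Γ) Δ
          → Pf ((s , A ∨' B) ∷ Γ) Δ
  L¬    : ∀ {Γ Δ s A} → Pf Γ ((s , A) ∷ Δ) → Pf ((s , ¬' A) ∷ Γ) Δ
  R¬    : ∀ {Γ Δ s A} → Pf ((s , A) ∷ Γ) Δ → Pf Γ ((s , ¬' A) ∷ Δ)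

combine : Side → LFm → LFm → LFm
combine lft I J = I ∨ˡ J
combine rgt I J = I ∧ˡ J

ℳ : ∀ {Γ Δ} → Pf Γ Δ → LFm
ℳ (ax lft lft p) = lit (pos lbot)
ℳ (ax rgt rgt p) = lit top
ℳ (ax lft rgt p) = lit (pos (lvar p))
ℳ (ax rgt lft p) = lit (neg (lvar p))
ℳ (ax⊥ lft)      = lit (pos lbot)
ℳ (ax⊥ rgt)      = lit top
ℳ (wL x π)       = ℳ π
ℳ (wR x π)       = ℳ π
ℳ (cL π)         = ℳ π
ℳ (cR π)         = ℳ π
ℳ (exL _ π)      = ℳ π
ℳ (exR _ π)      = ℳ π
ℳ (L∧₁ B π)      = ℳ π
ℳ (L∧₂ A π)      = ℳ π
ℳ (R∧ {s = s} π₁ π₂) = combine s (ℳ π₁) (ℳ π₂)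
ℳ (R∨₁ B π)      = ℳ π
ℳ (R∨₂ A π)      = ℳ π
ℳ (L∨ {s = s} π₁ π₂) = combine s (ℳ π₁) (ℳ π₂)
ℳ (L¬ π)         = ℳ π
ℳ (R¬ π)         = ℳ π

splitAnte : Fm → List SFm
splitAnte A = (lft , A) ∷ []

splitSucc : Clause → List SFm
splitSucc C = map (λ ℓ → (rgt , litFm ℓ)) C

module Submission where

open import Defs
open import Data.Bool using (true; false; not)
open import Data.Bool.Properties using (∨-zeroʳ)
open import Data.Empty using (⊥; ⊥-elim)
open import Data.List using ([]; _∷_; _++_)
open import Data.List.Properties using (++-identityʳ)
open import Data.List.Membership.Propositional using (_∈_)
open import Data.List.Membership.Propositional.Properties using (∈-++⁻)
open import Data.List.Relation.Binary.Permutation.Propositional using (↭-sym)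
open import Data.List.Relation.Binary.Permutation.Propositional.Properties using (All-resp-↭)
open import Data.List.Relation.Unary.All using (All; []; _∷_)
open import Data.List.Relation.Unary.Any using (here; there)
open import Data.List.Relation.Unary.Unique.Propositional using (Unique)
open import Data.Product using (Σ; _×_; _,_)
open import Data.Sum using ([_,_]′)
open import Data.Unit using (⊤; tt)
open import Relation.Binary.PropositionalEquality using (_≡_; refl; cong)

-- Follow π upwards from its end-sequent, maintaining that every
-- right-side formula is harmless: in the succedent it is ⊥ or a literal of C,
-- in the antecedent an atom p with ¬p ∈ C. Right-side main formulas are then
-- never compound, except ¬p in the succedent, which (R¬) turns into p in the
-- antecedent. So every binary rule has its main formula on the left and
-- contributes a disjunction, and the axioms contribute ⊥, p with p ∈ C, or
-- ¬p with ¬p ∈ C; the axiom ;p ⇒ ;p would need both p and ¬p in C. Hence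
-- ℳ(π) is a disjunction of literals of C and ⊥, whose CNF is one clause.

∈-disj-true : ∀ {ℓ C} v → ℓ ∈ C → eval v (litFm ℓ) ≡ true → eval v (disj C) ≡ true
∈-disj-true v (here refl) ℓ-true rewrite ℓ-true = refl
∈-disj-true v (there {x} ℓ∈C) ℓ-true
  rewrite ∈-disj-true v ℓ∈C ℓ-true = ∨-zeroʳ (eval v (litFm x))

valid-literal-∉ : ∀ {ℓ C} → NonTautological C → (∀ v → eval v (litFm ℓ) ≡ true) → ℓ ∈ C → ⊥
valid-literal-∉ nt ℓ-valid ℓ∈C = nt λ v → ∈-disj-true v ℓ∈C (ℓ-valid v)

NoComplementaryAtoms : Clause → Set
NoComplementaryAtoms C = ∀ {p} → pos (lvar p) ∈ C → neg (lvar p) ∈ C → ⊥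

nonTautological⇒noComplementaryAtoms : ∀ {C} → NonTautological C → NoComplementaryAtoms C
nonTautological⇒noComplementaryAtoms {C} nt {p} p∈C ¬p∈C = nt λ v → by-value v (v p) refl
  where
  by-value : ∀ v b → v p ≡ b → eval v (disj C) ≡ true
  by-value v true  vp≡true  = ∈-disj-true v p∈C vp≡true
  by-value v false vp≡false = ∈-disj-true v ¬p∈C (cong not vp≡false)

data Clausal (C : Clause) : LFm → Set where
  ⊥ᶜ   : Clausal C (lit (pos lbot))
  posᶜ : ∀ {p} → pos (lvar p) ∈ C → Clausal C (lit (pos (lvar p)))
  negᶜ : ∀ {p} → neg (lvar p) ∈ C → Clausal C (lit (neg (lvar p)))
  _∨ᶜ_ : ∀ {I J} → Clausal C I → Clausal C J → Clausal C (I ∨ˡ J)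

clausal-CNF : ∀ {C I} → Clausal C I → Σ Clause (λ M → (M ⊆ᶜ C) × (CNF I ≡ M ∷ []))
clausal-CNF ⊥ᶜ       = [] , (λ ()) , refl
clausal-CNF (posᶜ m) = _ , (λ { (here refl) → m }) , refl
clausal-CNF (negᶜ m) = _ , (λ { (here refl) → m }) , refl
clausal-CNF (g ∨ᶜ h) with clausal-CNF g | clausal-CNF h
... | M₁ , M₁⊆C , e₁ | M₂ , M₂⊆C , e₂ rewrite e₁ | e₂ =
  M₁ ++ M₂ , (λ m → [ M₁⊆C , M₂⊆C ]′ (∈-++⁻ M₁ m)) , ++-identityʳ _

singleton-IsSingleton : ∀ M → IsSingleton (M ∷ []) M
singleton-IsSingleton M =
  (λ { (here refl) → (λ m → m) , (λ m → m) }) , M , here refl , (λ m → m) , (λ m → m)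

data SuccLiteral (C : Clause) : Fm → Set where
  ⊥ˢ   : SuccLiteral C ⊥'
  posˢ : ∀ {p} → pos (lvar p) ∈ C → SuccLiteral C (var p)
  negˢ : ∀ {p} → neg (lvar p) ∈ C → SuccLiteral C (¬' var p)

data AnteAtom (C : Clause) : Fm → Set where
  negᵃ : ∀ {p} → neg (lvar p) ∈ C → AnteAtom C (var p)

OnRight : (Fm → Set) → SFm → Set
OnRight P (lft , _) = ⊤
OnRight P (rgt , F) = P F

module _ {C : Clause} (no-clash : NoComplementaryAtoms C) where

  ℳ-clausal : ∀ {Γ Δ} (π : Pf Γ Δ)
            → All (OnRight (AnteAtom C)) Γ → All (OnRight (SuccLiteral C)) Δ
            → Clausal C (ℳ π)
  ℳ-clausal (ax lft lft p) _ _ = ⊥ᶜ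
  ℳ-clausal (ax lft rgt p) _ (posˢ m ∷ []) = posᶜ m
  ℳ-clausal (ax rgt lft p) (negᵃ m ∷ []) _ = negᶜ m
  ℳ-clausal (ax rgt rgt p) (negᵃ ¬p∈C ∷ []) (posˢ p∈C ∷ []) = ⊥-elim (no-clash p∈C ¬p∈C)
  ℳ-clausal (ax⊥ lft) _ _ = ⊥ᶜ
  ℳ-clausal (ax⊥ rgt) (() ∷ []) _
  ℳ-clausal (wL x π) (_ ∷ a) s = ℳ-clausal π a s
  ℳ-clausal (wR x π) a (_ ∷ s) = ℳ-clausal π a s
  ℳ-clausal (cL π) (x ∷ a) s = ℳ-clausal π (x ∷ x ∷ a) s
  ℳ-clausal (cR π) a (x ∷ s) = ℳ-clausal π a (x ∷ x ∷ s)
  ℳ-clausal (exL p π) a s = ℳ-clausal π (All-resp-↭ (↭-sym p) a) s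
  ℳ-clausal (exR p π) a s = ℳ-clausal π a (All-resp-↭ (↭-sym p) s)
  ℳ-clausal (L∧₁ {s = lft} B π) (_ ∷ a) s = ℳ-clausal π (tt ∷ a) s
  ℳ-clausal (L∧₁ {s = rgt} B π) (() ∷ a) s
  ℳ-clausal (L∧₂ {s = lft} A π) (_ ∷ a) s = ℳ-clausal π (tt ∷ a) s
  ℳ-clausal (L∧₂ {s = rgt} A π) (() ∷ a) s
  ℳ-clausal (R∧ {s = lft} π₁ π₂) a (_ ∷ s) =
    ℳ-clausal π₁ a (tt ∷ s) ∨ᶜ ℳ-clausal π₂ a (tt ∷ s)
  ℳ-clausal (R∧ {s = rgt} π₁ π₂) a (() ∷ s)
  ℳ-clausal (R∨₁ {s = lft} B π) a (_ ∷ s) = ℳ-clausal π a (tt ∷ s)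
  ℳ-clausal (R∨₁ {s = rgt} B π) a (() ∷ s)
  ℳ-clausal (R∨₂ {s = lft} A π) a (_ ∷ s) = ℳ-clausal π a (tt ∷ s)
  ℳ-clausal (R∨₂ {s = rgt} A π) a (() ∷ s)
  ℳ-clausal (L∨ {s = lft} π₁ π₂) (_ ∷ a) s =
    ℳ-clausal π₁ (tt ∷ a) s ∨ᶜ ℳ-clausal π₂ (tt ∷ a) s
  ℳ-clausal (L∨ {s = rgt} π₁ π₂) (() ∷ a) s
  ℳ-clausal (L¬ {s = lft} π) (_ ∷ a) s = ℳ-clausal π a (tt ∷ s)
  ℳ-clausal (L¬ {s = rgt} π) (() ∷ a) s
  ℳ-clausal (R¬ {s = lft} π) a (_ ∷ s) = ℳ-clausal π (tt ∷ a) s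
  ℳ-clausal (R¬ {s = rgt} π) a (negˢ m ∷ s) = ℳ-clausal π (negᵃ m ∷ a) s

splitSucc-SuccLiteral : ∀ {C} → NonTautological C
                      → ∀ D → D ⊆ᶜ C → All (OnRight (SuccLiteral C)) (splitSucc D)
splitSucc-SuccLiteral nt [] _ = []
splitSucc-SuccLiteral nt (ℓ ∷ D) D⊆C =
  head ℓ (D⊆C (here refl)) ∷ splitSucc-SuccLiteral nt D (λ m → D⊆C (there m))
  where
  head : ∀ ℓ → ℓ ∈ _ → SuccLiteral _ (litFm ℓ)
  head (pos (lvar p)) m = posˢ m
  head (pos lbot)     _ = ⊥ˢ
  head (neg (lvar p)) m = negˢ m
  head (neg lbot)     m = ⊥-elim (valid-literal-∉ nt (λ v → refl) m)
  head top            m = ⊥-elim (valid-literal-∉ nt (λ v → refl) m)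

lemma4p5 : (A : Fm) (C : Clause) → Unique C → NonTautological C
         → (π : Pf (splitAnte A) (splitSucc C))
         → Σ Clause (λ M → (M ⊆ᶜ C) × IsSingleton (CNF (ℳ π)) M)
lemma4p5 A C _ nt π = from-CNF (clausal-CNF clausal)
  where
  clausal : Clausal C (ℳ π)
  clausal = ℳ-clausal (nonTautological⇒noComplementaryAtoms nt) π
                      (tt ∷ []) (splitSucc-SuccLiteral nt C (λ m → m))

  from-CNF : Σ Clause (λ M → (M ⊆ᶜ C) × (CNF (ℳ π) ≡ M ∷ []))
           → Σ Clause (λ M → (M ⊆ᶜ C) × IsSingleton (CNF (ℳ π)) M)
  from-CNF (M , M⊆C , CNF≡[M]) rewrite CNF≡[M] = M , M⊆C , singleton-IsSingleton M
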